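{- For every canonical system $\mathbf G$, every set of formulas $\mathcal T$ and every set $E$ of formulas with at most one element: $\mathcal{T}\vdash_{\mathbf G}E$ if and only if $\{\emptyset\Rightarrow\{\psi\}\mid\psi\in\mathcal{T}\}\vdash^{seq}_{\mathbf G}\ \emptyset\Rightarrow E$.
   Context: $\mathcal{L}$ is a propositional language with atoms $p_1,p_2,\ldots$ and set of formulas $\mathcal{F}$. A sequent is $\Gamma\Rightarrow E$ with $\Gamma$ a finite set of formulas and $E$ a set of formulas with at most one element. A clause is a sequent of atoms. An $\mathcal{L}$-substitution is a map $\sigma:\mathcal{F}\to\mathcal{F}$ commuting with all connectives, extended pointwise to sets. A canonical right-introduction rule for an $n$-ary connective $\diamond$ is $\{\Pi_i\Rightarrow E_i\}_{1\le i\le m}/\ \Rightarrow\diamond(p_1,\dots,p_n)$ with $m\ge0$ and $\Pi_i\cup E_i\subseteq\{p_1,\dots,p_n\}$; an application infers $\Gamma\Rightarrow\sigma(\diamond(p_1,\dots,p_n))$ from $\Gamma,\sigma(\Pi_i)\Rightarrow\sigma(E_i)$ ($1\le i\le m$), for any finite $\Gamma$ and substitution $\sigma$. A canonical left-introduction rule is $\langle\{\Pi_i\Rightarrow E_i\}_{1\le i\le m},\{\Sigma_j\Rightarrow\}_{1\le j\le k}\rangle/\ \diamond(p_1,\dots,p_n)\Rightarrow$ with all atoms among $p_1,\dots,p_n$; an application infers $\Gamma,\sigma(\diamond(p_1,\dots,p_n))\Rightarrow E$ from $\Gamma,\sigma(\Pi_i)\Rightarrow\sigma(E_i)$ and $\Gamma,\sigma(\Sigma_j)\Rightarrow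 E$, for any sequent $\Gamma\Rightarrow E$ and substitution $\sigma$. A canonical system has axioms $\varphi\Rightarrow\varphi$, weakening (from $\Gamma\Rightarrow E$ infer $\Gamma,\Delta\Rightarrow E$; from $\Gamma\Rightarrow$ infer $\Gamma\Rightarrow\psi$), cut (from $\Gamma\Rightarrow\varphi$ and $\Delta,\varphi\Rightarrow E$ infer $\Gamma,\Delta\Rightarrow E$), and a set of canonical right- and left-introduction rules. $\mathcal{S}\vdash^{seq}_{\mathbf G}s$ means $s$ is derivable in $\mathbf G$ from the sequents of $\mathcal S$ as extra axioms. $\mathcal{T}\vdash_{\mathbf G}E$ iff $\vdash^{seq}_{\mathbf G}\Gamma\Rightarrow E$ for some finite $\Gamma\subseteq\mathcal{T}$. -}

module Defs where

open import Level using (Level; _⊔_) renaming (suc to lsuc; zero to lzero)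
open import Data.Nat using (ℕ)
open import Data.Fin using (Fin; toℕ)
open import Data.Vec using (Vec; []; _∷_; tabulate)
open import Data.List using (List; []; _∷_; _++_; map)
open import Data.Maybe using (Maybe; just; nothing) renaming (map to mapMaybe)
open import Data.Product using (Σ; _×_; _,_)
open import Data.List.Membership.Propositional using (_∈_)
open import Relation.Binary.PropositionalEquality using (_≡_)
open import Relation.Unary using (Pred)
open import Function.Bundles using (_⇔_)

record Signature : Set₁ where
  field
    Conn  : Set
    arity : Conn → ℕ
open Signature public

module Lang (L : Signature) where

  data Formula : Set where
    atom : ℕ → Formula
    app  : (c : Conn L) → Vec Formula (arity L c) → Formula

  Subst : Set
  Subst = ℕ → Formula

  mutual
    sub : Subst → Formula → Formula
    sub σ (atom n)  = σ n
    sub σ (app c xs) = app c (subVec σ xs)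

    subVec : ∀ {k} → Subst → Vec Formula k → Vec Formula k
    subVec σ []       = []
    subVec σ (x ∷ xs) = sub σ x ∷ subVec σ xs

  -- Sequents Γ ⇒ E : Γ a finite set (represented by a list, taken up to
  -- having the same elements), E a set with at most one element.
  record Sequent : Set where
    constructor _⇒_
    field
      ant : List Formula
      suc : Maybe Formula

  _≈ₛ_ : List Formula → List Formula → Set
  Γ ≈ₛ Δ = ∀ φ → (φ ∈ Γ) ⇔ (φ ∈ Δ)

  p : ∀ {n} → Fin n → Formula
  p i = atom (toℕ i)

  schema : (c : Conn L) → Formula
  schema c = app c (tabulate p)

  record Clause (n : ℕ) : Set where
    field
      cant : List (Fin n)
      csuc : Maybe (Fin n)
  open Clause public

  subAnt : ∀ {n} → Subst → List (Fin n) → List Formula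
  subAnt σ Π = map (λ i → sub σ (p i)) Π

  subSuc : ∀ {n} → Subst → Maybe (Fin n) → Maybe Formula
  subSuc σ E = mapMaybe (λ i → sub σ (p i)) E

  -- Canonical right-introduction rule  {Π_i ⇒ E_i}_{i≤m} / ⇒ ◇(p_1..p_n)
  record RightRule : Set where
    field
      rconn  : Conn L
      rm     : ℕ
      rprem  : Fin rm → Clause (arity L rconn)

  -- Canonical left-introduction rule
  -- ⟨{Π_i ⇒ E_i}_{i≤m}, {Σ_j ⇒}_{j≤k}⟩ / ◇(p_1..p_n) ⇒
  record LeftRule : Set where
    field
      lconn  : Conn L
      lm     : ℕ
      lprem  : Fin lm → Clause (arity L lconn)
      lk     : ℕ
      lprem′ : Fin lk → List (Fin (arity L lconn))

  -- A canonical system: an arbitrary set (indexed family) of canonical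
  -- right- and left-introduction rules (plus the fixed structural rules).
  record CanonicalSystem : Set₁ where
    field
      RIdx  : Set
      rrule : RIdx → RightRule
      LIdx  : Set
      lrule : LIdx → LeftRule
  open CanonicalSystem public

  data Derivable {ℓ : Level} (G : CanonicalSystem) (S : Pred Sequent ℓ)
       : Sequent → Set (lsuc lzero ⊔ ℓ) where
    hyp    : ∀ {s} → S s → Derivable G S s
    ax     : ∀ φ → Derivable G S ((φ ∷ []) ⇒ just φ)
    -- sequents whose antecedents are the same finite set are identified
    setEq  : ∀ {Γ Δ E} → Γ ≈ₛ Δ → Derivable G S (Γ ⇒ E) → Derivable G S (Δ ⇒ E)
    weakL  : ∀ {Γ E} Δ → Derivable G S (Γ ⇒ E) → Derivable G S ((Γ ++ Δ) ⇒ E)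
    weakR  : ∀ {Γ} ψ → Derivable G S (Γ ⇒ nothing) → Derivable G S (Γ ⇒ just ψ)
    cut    : ∀ {Γ Δ φ E} → Derivable G S (Γ ⇒ just φ) → Derivable G S ((Δ ++ (φ ∷ [])) ⇒ E)
             → Derivable G S ((Γ ++ Δ) ⇒ E)
    right  : (r : RIdx G) (σ : Subst) (Γ : List Formula)
             → (∀ i → Derivable G S
                   ((Γ ++ subAnt σ (cant (RightRule.rprem (rrule G r) i)))
                     ⇒ subSuc σ (csuc (RightRule.rprem (rrule G r) i))))
             → Derivable G S (Γ ⇒ just (sub σ (schema (RightRule.rconn (rrule G r)))))
    left   : (r : LIdx G) (σ : Subst) (Γ : List Formula) (E : Maybe Formula)
             → (∀ i → Derivable G S
                   ((Γ ++ subAnt σ (cant (LeftRule.lprem (lrule G r) i)))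
                     ⇒ subSuc σ (csuc (LeftRule.lprem (lrule G r) i))))
             → (∀ j → Derivable G S
                   ((Γ ++ subAnt σ (LeftRule.lprem′ (lrule G r) j)) ⇒ E))
             → Derivable G S ((Γ ++ (sub σ (schema (LeftRule.lconn (lrule G r))) ∷ [])) ⇒ E)

  NoAxioms : Pred Sequent lzero
  NoAxioms _ = Data.Empty.⊥
    where import Data.Empty

  _⊢[_]_ : ∀ {ℓ} → Pred Formula ℓ → CanonicalSystem → Maybe Formula → Set (lsuc lzero ⊔ ℓ)
  T ⊢[ G ] E = Σ (List Formula) λ Γ → (∀ φ → φ ∈ Γ → T φ) × Derivable G NoAxioms (Γ ⇒ E)

  asAxioms : ∀ {ℓ} → Pred Formula ℓ → Pred Sequent (lzero ⊔ ℓ)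
  asAxioms T s = Σ Formula λ ψ → T ψ × (s ≡ ([] ⇒ just ψ))

-- Left to right: cut each assumption ψ ∈ Γ against its axiom ⇒ ψ.
-- Right to left: by induction on the derivation from the axioms, every sequent
-- Γ ⇒ E derived there is derivable without axioms once finitely many formulas
-- of T are added to Γ.  Axioms ⇒ ψ become the identity axioms ψ ⇒ ψ, and since
-- every rule of a canonical system allows an arbitrary context, the formulas
-- added for the premises of a rule can be carried along in its context.
module Submission where

open import Defs
open import Level using (Level)
open import Data.Fin using (Fin)
open import Data.List using (List; []; _∷_; _++_; concat; tabulate)
open import Data.List.Properties using (++-assoc; ++-identityʳ)
open import Data.List.Membership.Propositional.Properties
  using (∈-++⁺ˡ; ∈-++⁺ʳ; ∈-++⁻; ∈-concat⁺′; ∈-tabulate⁺)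
open import Data.List.Relation.Binary.Subset.Propositional using (_⊆_)
open import Data.List.Relation.Binary.Subset.Propositional.Properties
  using (⊆-refl; ⊆-reflexive; xs⊆xs++ys; xs⊆ys++xs; ++⁺ʳ; ++⁺ˡ)
open import Data.List.Relation.Unary.All as All using (All; []; _∷_)
open import Data.List.Relation.Unary.All.Properties using (++⁺; concat⁺; tabulate⁺)
open import Data.Maybe using (Maybe)
open import Data.Product using (Σ; _×_; _,_; proj₁; proj₂)
open import Data.Sum using (inj₁; inj₂; [_,_])
open import Function.Base using (id)
open import Function.Bundles using (_⇔_; mk⇔; Equivalence)
open import Relation.Binary.PropositionalEquality using (refl; sym)
open import Relation.Unary using (Pred)

swap-⊆ : ∀ {A : Set} (Γ : List A) {Π Δ Δ′} → Δ ⊆ Δ′ → (Γ ++ Π) ++ Δ ⊆ (Γ ++ Δ′) ++ Π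
swap-⊆ Γ {Π} Δ⊆Δ′ x∈ with ∈-++⁻ (Γ ++ Π) x∈
... | inj₂ x∈Δ = ∈-++⁺ˡ (∈-++⁺ʳ Γ (Δ⊆Δ′ x∈Δ))
... | inj₁ x∈ΓΠ with ∈-++⁻ Γ x∈ΓΠ
...   | inj₁ x∈Γ = ∈-++⁺ˡ (∈-++⁺ˡ x∈Γ)
...   | inj₂ x∈Π = ∈-++⁺ʳ _ x∈Π

interchange-⊆ : ∀ {A : Set} (Γ Π Δ Λ : List A) → (Γ ++ Π) ++ (Δ ++ Λ) ⊆ (Γ ++ Δ) ++ (Π ++ Λ)
interchange-⊆ Γ Π Δ Λ x∈ with ∈-++⁻ (Γ ++ Π) x∈
... | inj₁ x∈ΓΠ with ∈-++⁻ Γ x∈ΓΠ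
...   | inj₁ x∈Γ = ∈-++⁺ˡ (∈-++⁺ˡ x∈Γ)
...   | inj₂ x∈Π = ∈-++⁺ʳ (Γ ++ Δ) (∈-++⁺ˡ x∈Π)
interchange-⊆ Γ Π Δ Λ x∈ | inj₂ x∈ΔΛ with ∈-++⁻ Δ x∈ΔΛ
...   | inj₁ x∈Δ = ∈-++⁺ˡ (∈-++⁺ʳ Γ x∈Δ)
...   | inj₂ x∈Λ = ∈-++⁺ʳ (Γ ++ Δ) (∈-++⁺ʳ Π x∈Λ)

⋃ : ∀ {A : Set} {m} → (Fin m → List A) → List A
⋃ Δs = concat (tabulate Δs)

⊆-⋃ : ∀ {A : Set} {m} (Δs : Fin m → List A) i → Δs i ⊆ ⋃ Δs
⊆-⋃ Δs i x∈ = ∈-concat⁺′ x∈ (∈-tabulate⁺ i)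

module SequentCalculus (L : Signature) where
  open Lang L

  module _ {ℓ} {G : CanonicalSystem} {S : Pred Sequent ℓ} where

    weaken : ∀ {Γ Δ E} → Γ ⊆ Δ → Derivable G S (Γ ⇒ E) → Derivable G S (Δ ⇒ E)
    weaken {Γ} {Δ} Γ⊆Δ d =
      setEq (λ φ → mk⇔ (λ φ∈ → [ Γ⊆Δ , id ] (∈-++⁻ Γ φ∈)) (∈-++⁺ʳ Γ)) (weakL Δ d)

    Derivable-mono : ∀ {ℓ′} {S′ : Pred Sequent ℓ′} {s}
                   → (∀ {t} → S t → S′ t) → Derivable G S s → Derivable G S′ s
    Derivable-mono S⊆S′ (hyp s∈S) = hyp (S⊆S′ s∈S)
    Derivable-mono S⊆S′ (ax φ) = ax φ
    Derivable-mono S⊆S′ (setEq Γ≈Δ d) = setEq Γ≈Δ (Derivable-mono S⊆S′ d)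
    Derivable-mono S⊆S′ (weakL Δ d) = weakL Δ (Derivable-mono S⊆S′ d)
    Derivable-mono S⊆S′ (weakR ψ d) = weakR ψ (Derivable-mono S⊆S′ d)
    Derivable-mono S⊆S′ (cut d₁ d₂) = cut (Derivable-mono S⊆S′ d₁) (Derivable-mono S⊆S′ d₂)
    Derivable-mono S⊆S′ (right r σ Γ ds) = right r σ Γ (λ i → Derivable-mono S⊆S′ (ds i))
    Derivable-mono S⊆S′ (left r σ Γ E ds ds′) =
      left r σ Γ E (λ i → Derivable-mono S⊆S′ (ds i)) (λ j → Derivable-mono S⊆S′ (ds′ j))

  module _ {ℓ} {G : CanonicalSystem} {T : Pred Formula ℓ} where

    dischargeAxioms : ∀ {Δ Γ E} → All T Γ
                    → Derivable G (asAxioms T) ((Δ ++ Γ) ⇒ E) → Derivable G (asAxioms T) (Δ ⇒ E)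
    dischargeAxioms {Δ} {[]} [] d = weaken (⊆-reflexive (++-identityʳ Δ)) d
    dischargeAxioms {Δ} {φ ∷ Γ} (Tφ ∷ TΓ) d =
      cut (hyp (φ , Tφ , refl))
          (dischargeAxioms TΓ (weaken (⊆-reflexive (sym (++-assoc Δ (φ ∷ []) Γ))) d))

    DerivableUsing : Sequent → Set _
    DerivableUsing (Γ ⇒ E) = Σ (List Formula) λ Δ → All T Δ × Derivable G NoAxioms ((Γ ++ Δ) ⇒ E)

    shareAxioms : ∀ {m} {Γ : Fin m → List Formula} {E : Fin m → Maybe Formula}
                → (∀ i → DerivableUsing (Γ i ⇒ E i))
                → Σ (List Formula) λ Δ → All T Δ × (∀ i → Derivable G NoAxioms ((Γ i ++ Δ) ⇒ E i))
    shareAxioms {m} {Γ} ds =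
      ⋃ Δs , concat⁺ (tabulate⁺ λ i → proj₁ (proj₂ (ds i))) ,
      λ i → weaken (++⁺ʳ (Γ i) (⊆-⋃ Δs i)) (proj₂ (proj₂ (ds i)))
      where
        Δs : Fin m → List Formula
        Δs i = proj₁ (ds i)

    eliminateAxioms : ∀ {s} → Derivable G (asAxioms T) s → DerivableUsing s
    eliminateAxioms (hyp (ψ , Tψ , refl)) = ψ ∷ [] , Tψ ∷ [] , ax ψ
    eliminateAxioms (ax φ) = [] , [] , weaken (xs⊆xs++ys _ []) (ax φ)
    eliminateAxioms (setEq Γ≈Γ′ d) =
      let Δ , TΔ , d′ = eliminateAxioms d
      in  Δ , TΔ , weaken (++⁺ˡ Δ (λ {φ} → Equivalence.to (Γ≈Γ′ φ))) d′
    eliminateAxioms (weakL {Γ} Γ′ d) =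
      let Δ , TΔ , d′ = eliminateAxioms d
      in  Δ , TΔ , weaken (++⁺ˡ Δ (xs⊆xs++ys Γ Γ′)) d′
    eliminateAxioms (weakR ψ d) =
      let Δ , TΔ , d′ = eliminateAxioms d
      in  Δ , TΔ , weakR ψ d′
    eliminateAxioms (cut {Γ} {Γ′} d₁ d₂) =
      let Δ₁ , TΔ₁ , d₁′ = eliminateAxioms d₁
          Δ₂ , TΔ₂ , d₂′ = eliminateAxioms d₂
      in  Δ₁ ++ Δ₂ , ++⁺ TΔ₁ TΔ₂ ,
          weaken (interchange-⊆ Γ Δ₁ Γ′ Δ₂)
            (cut {Γ = Γ ++ Δ₁} {Δ = Γ′ ++ Δ₂} d₁′ (weaken (swap-⊆ Γ′ ⊆-refl) d₂′))
    eliminateAxioms (right r σ Γ ds) =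
      let Δ , TΔ , ds′ = shareAxioms (λ i → eliminateAxioms (ds i))
      in  Δ , TΔ , right r σ (Γ ++ Δ) (λ i → weaken (swap-⊆ Γ ⊆-refl) (ds′ i))
    eliminateAxioms (left r σ Γ E ds ds′) =
      let Δ₁ , TΔ₁ , es  = shareAxioms (λ i → eliminateAxioms (ds i))
          Δ₂ , TΔ₂ , es′ = shareAxioms (λ j → eliminateAxioms (ds′ j))
      in  Δ₁ ++ Δ₂ , ++⁺ TΔ₁ TΔ₂ ,
          weaken (swap-⊆ Γ ⊆-refl)
            (left r σ (Γ ++ Δ₁ ++ Δ₂) E
              (λ i → weaken (swap-⊆ Γ (xs⊆xs++ys Δ₁ Δ₂)) (es i))
              (λ j → weaken (swap-⊆ Γ (xs⊆ys++xs Δ₂ Δ₁)) (es′ j)))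

proposition3p11 : (L : Signature) → let open Lang L in
    ∀ {ℓ : Level} (G : CanonicalSystem) (T : Pred Formula ℓ) (E : Maybe Formula) →
    (T ⊢[ G ] E) ⇔ Derivable G (asAxioms T) ([] ⇒ E)
proposition3p11 L G T E = mk⇔
  (λ (Γ , Γ⊆T , d) → dischargeAxioms {Δ = []} (All.tabulate (Γ⊆T _)) (Derivable-mono (λ ()) d))
  (λ d → let Δ , TΔ , d′ = eliminateAxioms d in Δ , (λ _ → All.lookup TΔ) , d′)
  where open SequentCalculus L
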